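{- There exist absolute constants $C>0$ and $c>0$ such that for every prime power $q$ and all sets $A,B,D\subset M_2(\mathbb{F}_q)$ with $|A||B||D|\ge C\,q^{11}$, the set $\{a+bd: a\in A,\ b\in B,\ d\in D\}$ has at least $c\,q^4$ elements.
   Context: $\mathbb{F}_q$ is the finite field with $q$ elements and $M_2(\mathbb{F}_q)$ is the ring of $2\times 2$ matrices over $\mathbb{F}_q$. -}

module Defs where

open import Level using (0ℓ)
open import Data.Nat using (ℕ)
open import Data.Fin using (Fin)
open import Data.Product using (Σ; ∃; _×_; _,_)
open import Data.List using (List; length)
open import Data.List.Membership.Propositional using (_∈_)
open import Data.List.Relation.Unary.Unique.Propositional using (Unique)
open import Relation.Binary.PropositionalEquality using (_≡_; _≢_)
open import Relation.Nullary using (¬_)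
open import Function.Bundles using (_↔_)
open import Algebra.Structures using (IsCommutativeRing)

-- A finite field: a commutative ring (w.r.t. propositional equality) with
-- 0 ≠ 1, in which every nonzero element has a multiplicative inverse, and
-- whose carrier is in bijection with Fin size.  (size is then the q of F_q;
-- finite fields are exactly the F_q for q a prime power.)
record FiniteField : Set₁ where
  field
    Carrier : Set
    _+_ _*_ : Carrier → Carrier → Carrier
    -_      : Carrier → Carrier
    0# 1#   : Carrier
    isCommutativeRing : IsCommutativeRing _≡_ _+_ _*_ -_ 0# 1#
    0≢1     : 0# ≢ 1#
    inverse : ∀ x → x ≢ 0# → Σ Carrier λ y → x * y ≡ 1#
    size    : ℕ
    enum    : Carrier ↔ Fin size

record M2 (F : FiniteField) : Set where
  constructor mat
  open FiniteField F
  field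
    m11 m12 m21 m22 : Carrier

module _ {F : FiniteField} where
  open FiniteField F

  _+ₘ_ : M2 F → M2 F → M2 F
  mat a b c d +ₘ mat a' b' c' d' = mat (a + a') (b + b') (c + c') (d + d')

  _*ₘ_ : M2 F → M2 F → M2 F
  mat a b c d *ₘ mat a' b' c' d' =
    mat ((a * a') + (b * c')) ((a * b') + (b * d'))
        ((c * a') + (d * c')) ((c * b') + (d * d'))

record FinSet (F : FiniteField) : Set where
  field
    elems  : List (M2 F)
    unique : Unique elems

card : {F : FiniteField} → FinSet F → ℕ
card S = length (FinSet.elems S)

_∈ₛ_ : {F : FiniteField} → M2 F → FinSet F → Set
x ∈ₛ S = x ∈ FinSet.elems S

InSumProd : {F : FiniteField} → FinSet F → FinSet F → FinSet F → M2 F → Set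
InSumProd A B D x =
  ∃ λ a → ∃ λ b → ∃ λ d → a ∈ₛ A × b ∈ₛ B × d ∈ₛ D × x ≡ (a +ₘ (b *ₘ d))

{-# OPTIONS --safe #-}
module Submission where

-- A second-moment argument.  Let n = q⁴ = |M₂(F_q)|, S = A + BD with s = |S|, and for a pair
-- (a, b) of matrices let h(a, b) = #{d ∈ D : a + bd ∈ S}.  Translating a shows that h has
-- mean |D| s / n.  For d, d′ ∈ D the substitution a ↦ a − bd turns Σ 1_S(a + bd) 1_S(a + bd′)
-- into Σ 1_S(a) 1_S(a + b(d′ − d)), which is s² when d′ − d is invertible (b ↦ b(d′ − d) is then
-- a bijection) and at most n s otherwise.  At most 2q³ matrices are singular, so the variance of
-- h is at most 2q³ |D| s / n.  On A × B, however, h is identically |D|, so Chebyshev's inequality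
-- gives |A| |B| |D| (n − s)² ≤ 2q³ n³ s; together with |A| |B| |D| ≥ 4q¹¹ this forces n ≤ 2s.

open import Defs

module Arithmetic where

  open import Data.Nat
  open import Data.Nat.Properties
  open import Data.Nat.Solver using (module +-*-Solver)
  open import Data.Product using (_,_)
  open import Data.Sum using (inj₁; inj₂)
  open import Relation.Binary.PropositionalEquality
  open import Relation.Nullary using (yes; no; contradiction)

  a+Nk≡Nr⇒a≤Ny : ∀ {a k r y} N → a + N * k ≡ N * r → r ≤ k + y → a ≤ N * y
  a+Nk≡Nr⇒a≤Ny {a} {k} {r} {y} N a+Nk≡Nr r≤k+y = +-cancelʳ-≤ (N * k) a (N * y) (begin
    a + N * k        ≡⟨ a+Nk≡Nr ⟩
    N * r            ≤⟨ *-monoʳ-≤ N r≤k+y ⟩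
    N * (k + y)      ≡⟨ *-distribˡ-+ N k y ⟩
    N * k + N * y    ≡⟨ +-comm (N * k) (N * y) ⟩
    N * y + N * k    ∎)
    where open ≤-Reasoning

  m≤n⇒∣m-n∣²+2mn≡m²+n² : ∀ {m n} → m ≤ n → ∣ m - n ∣ * ∣ m - n ∣ + 2 * (m * n) ≡ m * m + n * n
  m≤n⇒∣m-n∣²+2mn≡m²+n² {m} m≤n with d , refl ← m≤n⇒∃[o]m+o≡n m≤n =
    trans (cong (λ e → e * e + 2 * (m * (m + d))) (∣m-m+n∣≡n m d))
          (solve 2 (λ m d → d :* d :+ con 2 :* (m :* (m :+ d)) := m :* m :+ (m :+ d) :* (m :+ d)) refl m d)
    where open +-*-Solver

  ∣m-n∣²+2mn≡m²+n² : ∀ m n → ∣ m - n ∣ * ∣ m - n ∣ + 2 * (m * n) ≡ m * m + n * n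
  ∣m-n∣²+2mn≡m²+n² m n with ≤-total m n
  ... | inj₁ m≤n = m≤n⇒∣m-n∣²+2mn≡m²+n² m≤n
  ... | inj₂ n≤m = begin
    ∣ m - n ∣ * ∣ m - n ∣ + 2 * (m * n)  ≡⟨ cong₂ (λ e f → e * e + 2 * f) (∣-∣-comm m n) (*-comm m n) ⟩
    ∣ n - m ∣ * ∣ n - m ∣ + 2 * (n * m)  ≡⟨ m≤n⇒∣m-n∣²+2mn≡m²+n² n≤m ⟩
    n * n + m * m                        ≡⟨ +-comm (n * n) (m * m) ⟩
    m * m + n * n                        ∎
    where open ≡-Reasoning

  2t²≤[s+t]s⇒t≤s : ∀ s t → 2 * (t * t) ≤ (s + t) * s → t ≤ s
  2t²≤[s+t]s⇒t≤s s t 2t²≤[s+t]s with t ≤? s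
  ... | yes t≤s = t≤s
  ... | no  t≰s = contradiction 2t²≤[s+t]s (<⇒≱ (begin-strict
    (s + t) * s      ≡⟨ *-distribʳ-+ s s t ⟩
    s * s + t * s    <⟨ +-mono-≤-< (*-mono-≤ (<⇒≤ s<t) (<⇒≤ s<t)) (*-monoʳ-< t {{>-nonZero (≤-<-trans z≤n s<t)}} s<t) ⟩
    t * t + t * t    ≡⟨ cong (t * t +_) (+-identityʳ (t * t)) ⟨
    2 * (t * t)      ∎))
    where
    open ≤-Reasoning
    s<t = ≰⇒> t≰s

  4q¹¹≤αβδ⇒2t²≤q⁴s : ∀ q {s t δ αβ} .{{_ : NonZero q}} → 4 * q ^ 11 ≤ αβ * δ →
    αβ * ((δ * t) * (δ * t)) ≤ q ^ 4 * q ^ 4 * (δ * (2 * q ^ 3) * (q ^ 4 * s)) → 2 * (t * t) ≤ q ^ 4 * s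
  4q¹¹≤αβδ⇒2t²≤q⁴s q {δ = zero} {αβ} 4q¹¹≤αβ0 _ =
    contradiction (subst (4 * q ^ 11 ≤_) (*-zeroʳ αβ) 4q¹¹≤αβ0) (<⇒≱ (*-monoʳ-< 4 (m^n>0 q 11)))
  4q¹¹≤αβδ⇒2t²≤q⁴s q {s} {t} {δ@(suc _)} {αβ} 4q¹¹≤αβδ bound =
    *-cancelˡ-≤ 2 (*-cancelˡ-≤ (q ^ 11 * δ) {{m*n≢0 (q ^ 11) δ {{m^n≢0 q 11}}}} (begin
      q ^ 11 * δ * (2 * (2 * (t * t)))
        ≡⟨ solve 3 (λ Q δ t → Q :* δ :* (con 2 :* (con 2 :* (t :* t))) := con 4 :* Q :* (δ :* (t :* t))) refl (q ^ 11) δ t ⟩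
      4 * q ^ 11 * (δ * (t * t))
        ≤⟨ *-monoˡ-≤ (δ * (t * t)) 4q¹¹≤αβδ ⟩
      αβ * δ * (δ * (t * t))
        ≡⟨ solve 3 (λ αβ δ t → αβ :* δ :* (δ :* (t :* t)) := αβ :* ((δ :* t) :* (δ :* t))) refl αβ δ t ⟩
      αβ * ((δ * t) * (δ * t))
        ≤⟨ bound ⟩
      q ^ 4 * q ^ 4 * (δ * (2 * q ^ 3) * (q ^ 4 * s))
        ≡⟨ solve 3 (λ q δ s → q :^ 4 :* q :^ 4 :* (δ :* (con 2 :* q :^ 3) :* (q :^ 4 :* s))
                             := q :^ 11 :* δ :* (con 2 :* (q :^ 4 :* s))) refl q δ s ⟩
      q ^ 11 * δ * (2 * (q ^ 4 * s))
        ∎))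
    where
    open ≤-Reasoning
    open +-*-Solver

module FiniteSums where

  open import Data.Nat using (ℕ; _+_; _*_; _≤_; z≤n; ∣_-_∣)
  open import Data.Nat.Properties
  open import Data.Nat.ListAction using (sum)
  open import Data.Nat.ListAction.Properties using (sum-++)
  open import Data.Nat.Solver using (module +-*-Solver)
  open import Algebra.Properties.CommutativeSemigroup +-commutativeSemigroup using (interchange)
  open import Function using (_∘_; _∘′_)
  open import Data.Product using (_,_)
  open import Data.Sum using (inj₁; inj₂)
  open import Data.List using (List; []; _∷_; _++_; map; length; filter; cartesianProductWith)
  open import Data.List.Properties using (map-++; map-∘)
  open import Data.List.Membership.Propositional using (_∈_)
  open import Data.List.Membership.Propositional.Properties using (∈-∃++; ∈-++⁻; ∈-++⁺ˡ; ∈-++⁺ʳ; ∈-map⁺)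
  open import Data.List.Relation.Unary.Any using (here; there)
  import Data.List.Relation.Unary.All as All
  open import Data.List.Relation.Unary.AllPairs using (_∷_)
  open import Data.List.Relation.Unary.Unique.Propositional using (Unique)
  import Data.List.Relation.Unary.Unique.Propositional.Properties as Unique
  open import Data.List.Relation.Binary.Subset.Propositional using (_⊆_)
  open import Relation.Binary.PropositionalEquality
  open import Relation.Nullary using (Dec; yes; no; ¬_; contradiction)
  open import Relation.Unary using (Pred; Decidable)
  open Arithmetic using (∣m-n∣²+2mn≡m²+n²)

  𝟙 : ∀ {p} {P : Set p} → Dec P → ℕ
  𝟙 (yes _) = 1
  𝟙 (no _)  = 0

  𝟙≤1 : ∀ {p} {P : Set p} (P? : Dec P) → 𝟙 P? ≤ 1
  𝟙≤1 (yes _) = ≤-refl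
  𝟙≤1 (no _)  = z≤n

  module _ {X : Set} where

    ∑ : List X → (X → ℕ) → ℕ
    ∑ xs f = sum (map f xs)

    ∑-cong : ∀ xs {f g : X → ℕ} → (∀ {x} → x ∈ xs → f x ≡ g x) → ∑ xs f ≡ ∑ xs g
    ∑-cong []       eq = refl
    ∑-cong (x ∷ xs) eq = cong₂ _+_ (eq (here refl)) (∑-cong xs (eq ∘′ there))

    ∑-mono : ∀ xs {f g : X → ℕ} → (∀ x → f x ≤ g x) → ∑ xs f ≤ ∑ xs g
    ∑-mono []       le = z≤n
    ∑-mono (x ∷ xs) le = +-mono-≤ (le x) (∑-mono xs le)

    ∑-+ : ∀ xs (f g : X → ℕ) → ∑ xs (λ x → f x + g x) ≡ ∑ xs f + ∑ xs g
    ∑-+ []       f g = refl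
    ∑-+ (x ∷ xs) f g = trans (cong (f x + g x +_) (∑-+ xs f g)) (interchange (f x) (g x) _ _)

    ∑-*ˡ : ∀ xs k (f : X → ℕ) → ∑ xs (λ x → k * f x) ≡ k * ∑ xs f
    ∑-*ˡ []       k f = sym (*-zeroʳ k)
    ∑-*ˡ (x ∷ xs) k f = trans (cong (k * f x +_) (∑-*ˡ xs k f)) (sym (*-distribˡ-+ k (f x) _))

    ∑-*ʳ : ∀ xs k (f : X → ℕ) → ∑ xs (λ x → f x * k) ≡ ∑ xs f * k
    ∑-*ʳ xs k f = trans (∑-cong xs (λ {x} _ → *-comm (f x) k)) (trans (∑-*ˡ xs k f) (*-comm k _))

    ∑-const : ∀ xs k → ∑ xs (λ _ → k) ≡ length xs * k
    ∑-const []       k = refl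
    ∑-const (x ∷ xs) k = cong (k +_) (∑-const xs k)

    ∑-++ : ∀ xs ys (f : X → ℕ) → ∑ (xs ++ ys) f ≡ ∑ xs f + ∑ ys f
    ∑-++ xs ys f = trans (cong sum (map-++ f xs ys)) (sum-++ (map f xs) (map f ys))

    ∑-mono-⊆ : ∀ {xs ys} (g : X → ℕ) → Unique xs → xs ⊆ ys → ∑ xs g ≤ ∑ ys g
    ∑-mono-⊆ {[]}     g _             _   = z≤n
    ∑-mono-⊆ {x ∷ xs} g (x∉xs ∷ !xs) xs⊆ys with ys₁ , ys₂ , refl ← ∈-∃++ (xs⊆ys (here refl)) = begin
      g x + ∑ xs g               ≤⟨ +-monoʳ-≤ (g x) (∑-mono-⊆ g !xs xs⊆ys₁++ys₂) ⟩
      g x + ∑ (ys₁ ++ ys₂) g     ≡⟨ cong (g x +_) (∑-++ ys₁ ys₂ g) ⟩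
      g x + (∑ ys₁ g + ∑ ys₂ g)  ≡⟨ x+[y+z]≡y+[x+z] (g x) (∑ ys₁ g) (∑ ys₂ g) ⟩
      ∑ ys₁ g + (g x + ∑ ys₂ g)  ≡⟨ ∑-++ ys₁ (x ∷ ys₂) g ⟨
      ∑ (ys₁ ++ x ∷ ys₂) g       ∎
      where
      open ≤-Reasoning
      x+[y+z]≡y+[x+z] : ∀ a b c → a + (b + c) ≡ b + (a + c)
      x+[y+z]≡y+[x+z] a b c = trans (sym (+-assoc a b c)) (trans (cong (_+ c) (+-comm a b)) (+-assoc b a c))
      xs⊆ys₁++ys₂ : xs ⊆ ys₁ ++ ys₂
      xs⊆ys₁++ys₂ {y} y∈xs with ∈-++⁻ ys₁ (xs⊆ys (there y∈xs))
      ... | inj₁ y∈ys₁         = ∈-++⁺ˡ y∈ys₁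
      ... | inj₂ (here refl)   = contradiction refl (All.lookup x∉xs y∈xs)
      ... | inj₂ (there y∈ys₂) = ∈-++⁺ʳ ys₁ y∈ys₂

    ∑-⊆-antisym : ∀ {xs ys} (g : X → ℕ) → Unique xs → Unique ys → xs ⊆ ys → ys ⊆ xs → ∑ xs g ≡ ∑ ys g
    ∑-⊆-antisym g !xs !ys xs⊆ys ys⊆xs = ≤-antisym (∑-mono-⊆ g !xs xs⊆ys) (∑-mono-⊆ g !ys ys⊆xs)

    ∑-reindex : ∀ {U} → Unique U → (∀ x → x ∈ U) → {φ ψ : X → X} → (∀ x → ψ (φ x) ≡ x) → (∀ y → φ (ψ y) ≡ y) →
                (g : X → ℕ) → ∑ U (g ∘ φ) ≡ ∑ U g
    ∑-reindex {U} !U U-complete {φ} {ψ} ψ∘φ φ∘ψ g = begin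
      ∑ U (g ∘ φ)    ≡⟨ cong sum (map-∘ U) ⟩
      ∑ (map φ U) g  ≡⟨ ∑-⊆-antisym g (Unique.map⁺ φ-injective !U) !U (λ _ → U-complete _) φU-complete ⟩
      ∑ U g          ∎
      where
      open ≡-Reasoning
      φ-injective : ∀ {x y} → φ x ≡ φ y → x ≡ y
      φ-injective {x} {y} eq = trans (sym (ψ∘φ x)) (trans (cong ψ eq) (ψ∘φ y))
      φU-complete : U ⊆ map φ U
      φU-complete {y} _ = subst (_∈ map φ U) (φ∘ψ y) (∈-map⁺ φ (U-complete (ψ y)))

    module _ {p} {P : Pred X p} (P? : Decidable P) where

      ∑-𝟙≡length-filter : ∀ xs → ∑ xs (𝟙 ∘ P?) ≡ length (filter P? xs)
      ∑-𝟙≡length-filter []       = refl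
      ∑-𝟙≡length-filter (x ∷ xs) with P? x
      ... | yes _ = cong (1 +_) (∑-𝟙≡length-filter xs)
      ... | no _  = ∑-𝟙≡length-filter xs

      ∑-𝟙≡0 : ∀ {xs} → All.All (¬_ ∘ P) xs → ∑ xs (𝟙 ∘ P?) ≡ 0
      ∑-𝟙≡0 {[]}     All.[]          = refl
      ∑-𝟙≡0 {x ∷ xs} (¬Px All.∷ ¬Pxs) with P? x
      ... | yes Px = contradiction Px ¬Px
      ... | no _   = ∑-𝟙≡0 ¬Pxs

      ∑-𝟙≤1 : ∀ {xs} → Unique xs → (∀ {x y} → P x → P y → x ≡ y) → ∑ xs (𝟙 ∘ P?) ≤ 1
      ∑-𝟙≤1 {[]}     _            _      = z≤n
      ∑-𝟙≤1 {x ∷ xs} (x∉xs ∷ !xs) P-prop with P? x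
      ... | yes Px = ≤-reflexive (cong (1 +_) (∑-𝟙≡0 (All.map (λ x≢y Py → x≢y (P-prop Px Py)) x∉xs)))
      ... | no _   = ∑-𝟙≤1 !xs P-prop

  ∑-map : ∀ {X Y : Set} (φ : X → Y) xs (g : Y → ℕ) → ∑ (map φ xs) g ≡ ∑ xs (g ∘ φ)
  ∑-map φ xs g = cong sum (sym (map-∘ xs))

  module _ {X Y : Set} where

    ∑-swap : ∀ xs ys (h : X → Y → ℕ) → ∑ xs (λ x → ∑ ys (h x)) ≡ ∑ ys (λ y → ∑ xs (λ x → h x y))
    ∑-swap []       ys h = sym (trans (∑-const ys 0) (*-zeroʳ (length ys)))
    ∑-swap (x ∷ xs) ys h = trans (cong (∑ ys (h x) +_) (∑-swap xs ys h)) (sym (∑-+ ys (h x) _))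

    ∑-*-∑ : ∀ xs ys (f : X → ℕ) (g : Y → ℕ) → ∑ xs f * ∑ ys g ≡ ∑ xs (λ x → ∑ ys (λ y → f x * g y))
    ∑-*-∑ xs ys f g = trans (sym (∑-*ʳ xs (∑ ys g) f)) (∑-cong xs (λ {x} _ → sym (∑-*ˡ ys (f x) g)))

    ∑-cartesianProductWith : ∀ {Z : Set} (φ : X → Y → Z) xs ys (g : Z → ℕ) →
      ∑ (cartesianProductWith φ xs ys) g ≡ ∑ xs (λ x → ∑ ys (λ y → g (φ x y)))
    ∑-cartesianProductWith φ []       ys g = refl
    ∑-cartesianProductWith φ (x ∷ xs) ys g = begin
      ∑ (map (φ x) ys ++ cartesianProductWith φ xs ys) g                  ≡⟨ ∑-++ (map (φ x) ys) _ g ⟩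
      ∑ (map (φ x) ys) g + ∑ (cartesianProductWith φ xs ys) g             ≡⟨ cong₂ _+_ (∑-map (φ x) ys g) (∑-cartesianProductWith φ xs ys g) ⟩
      ∑ ys (λ y → g (φ x y)) + ∑ xs (λ x′ → ∑ ys (λ y → g (φ x′ y)))      ∎
      where open ≡-Reasoning

  length-cartesianProductWith : ∀ {X Y Z : Set} (φ : X → Y → Z) xs ys →
    length (cartesianProductWith φ xs ys) ≡ length xs * length ys
  length-cartesianProductWith φ xs ys = begin
    length (cartesianProductWith φ xs ys)     ≡⟨ length≡∑1 (cartesianProductWith φ xs ys) ⟩
    ∑ (cartesianProductWith φ xs ys) (λ _ → 1) ≡⟨ ∑-cartesianProductWith φ xs ys _ ⟩
    ∑ xs (λ _ → ∑ ys (λ _ → 1))               ≡⟨ ∑-cong xs (λ _ → sym (length≡∑1 ys)) ⟩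
    ∑ xs (λ _ → length ys)                    ≡⟨ ∑-const xs (length ys) ⟩
    length xs * length ys                     ∎
    where
    open ≡-Reasoning
    length≡∑1 : ∀ {X : Set} (xs : List X) → length xs ≡ ∑ xs (λ _ → 1)
    length≡∑1 xs = sym (trans (∑-const xs 1) (*-identityʳ (length xs)))

  module _ {X : Set} where

    ∑-∣-∣²-expansion : ∀ xs (f : X → ℕ) c μ →
      ∑ xs (λ x → ∣ c * f x - μ ∣ * ∣ c * f x - μ ∣) + 2 * (c * μ) * ∑ xs f
        ≡ c * c * ∑ xs (λ x → f x * f x) + length xs * (μ * μ)
    ∑-∣-∣²-expansion xs f c μ = begin
      ∑ xs sq + 2 * (c * μ) * ∑ xs f                         ≡⟨ cong (∑ xs sq +_) (∑-*ˡ xs (2 * (c * μ)) f) ⟨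
      ∑ xs sq + ∑ xs (λ x → 2 * (c * μ) * f x)               ≡⟨ ∑-+ xs sq _ ⟨
      ∑ xs (λ x → sq x + 2 * (c * μ) * f x)                  ≡⟨ ∑-cong xs (λ {x} _ → pointwise x) ⟩
      ∑ xs (λ x → c * c * (f x * f x) + μ * μ)               ≡⟨ ∑-+ xs _ _ ⟩
      ∑ xs (λ x → c * c * (f x * f x)) + ∑ xs (λ _ → μ * μ)  ≡⟨ cong₂ _+_ (∑-*ˡ xs (c * c) _) (∑-const xs (μ * μ)) ⟩
      c * c * ∑ xs (λ x → f x * f x) + length xs * (μ * μ)   ∎
      where
      open ≡-Reasoning
      sq : X → ℕ
      sq x = ∣ c * f x - μ ∣ * ∣ c * f x - μ ∣
      pointwise : ∀ x → sq x + 2 * (c * μ) * f x ≡ c * c * (f x * f x) + μ * μ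
      pointwise x = begin
        sq x + 2 * (c * μ) * f x          ≡⟨ cong (sq x +_) (solve 3 (λ c μ y → con 2 :* (c :* μ) :* y := con 2 :* ((c :* y) :* μ)) refl c μ (f x)) ⟩
        sq x + 2 * (c * f x * μ)          ≡⟨ ∣m-n∣²+2mn≡m²+n² (c * f x) μ ⟩
        c * f x * (c * f x) + μ * μ       ≡⟨ cong (_+ μ * μ) (solve 2 (λ c y → c :* y :* (c :* y) := c :* c :* (y :* y)) refl c (f x)) ⟩
        c * c * (f x * f x) + μ * μ       ∎
        where open +-*-Solver

    ∑-variance : ∀ xs (f : X → ℕ) c μ → c * ∑ xs f ≡ length xs * μ →
      ∑ xs (λ x → ∣ c * f x - μ ∣ * ∣ c * f x - μ ∣) + length xs * (μ * μ) ≡ c * c * ∑ xs (λ x → f x * f x)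
    ∑-variance xs f c μ c∑f≡Lμ = +-cancelʳ-≡ _ _ _ (begin
      V + L * (μ * μ) + L * (μ * μ)     ≡⟨ +-assoc V _ _ ⟩
      V + (L * (μ * μ) + L * (μ * μ))   ≡⟨ cong (V +_) (solve 2 (λ L μ → L :* (μ :* μ) :+ L :* (μ :* μ) := con 2 :* μ :* (L :* μ)) refl L μ) ⟩
      V + 2 * μ * (L * μ)               ≡⟨ cong (λ e → V + 2 * μ * e) c∑f≡Lμ ⟨
      V + 2 * μ * (c * ∑ xs f)          ≡⟨ cong (V +_) (solve 3 (λ μ c t → con 2 :* μ :* (c :* t) := con 2 :* (c :* μ) :* t) refl μ c (∑ xs f)) ⟩
      V + 2 * (c * μ) * ∑ xs f          ≡⟨ ∑-∣-∣²-expansion xs f c μ ⟩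
      c * c * ∑ xs (λ x → f x * f x) + L * (μ * μ) ∎)
      where
      open ≡-Reasoning
      open +-*-Solver
      L = length xs
      V = ∑ xs (λ x → ∣ c * f x - μ ∣ * ∣ c * f x - μ ∣)

module Matrices (F : FiniteField) where

  open import Data.Nat as ℕ using (ℕ; _^_; _≤_)
  import Data.Nat.Properties as ℕₚ
  import Data.Nat.Solver
  module NatSolver = Data.Nat.Solver.+-*-Solver
  open import Data.Fin.Properties using (inj⇒≟; nonZeroIndex)
  open import Data.Product using (_×_; _,_; proj₁; proj₂)
  open import Data.Product.Properties using (≡-dec)
  open import Data.List using (List; map; length; allFin; cartesianProductWith; cartesianProduct)
  open import Data.List.Properties using (length-map; length-tabulate)
  open import Data.List.Membership.Propositional using (_∈_)
  open import Data.List.Membership.Propositional.Properties using (∈-map⁺; ∈-allFin; ∈-cartesianProductWith⁺; ∈-cartesianProduct⁺)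
  open import Data.List.Relation.Unary.Unique.Propositional using (Unique)
  import Data.List.Relation.Unary.Unique.Propositional.Properties as Unique
  open import Function using (Inverse)
  open import Function.Bundles using (mk↣)
  open import Function.Properties.Inverse using (↔⇒↣)
  open import Relation.Binary.PropositionalEquality
  open import Relation.Nullary using (yes; no)
  open import Relation.Binary.Definitions using (DecidableEquality)
  open import Relation.Nullary.Decidable using (via-injection)
  open import Algebra.Bundles using (CommutativeRing)
  open FiniteSums

  open FiniteField F using (Carrier; size; enum; inverse)
  open Inverse enum using (to; from; strictlyInverseˡ; strictlyInverseʳ)

  ring : CommutativeRing _ _
  ring = record { isCommutativeRing = FiniteField.isCommutativeRing F }

  open CommutativeRing ring
    using ( _+_; _*_; -_; _-_; 0#; 1#; +-comm; +-identityˡ; +-identityʳ; *-comm; *-assoc; *-identityˡ; *-identityʳ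
          ; zeroʳ; -‿inverseʳ; -‿inverseˡ; +-group; commutativeSemiring)
  open import Algebra.Properties.Ring (CommutativeRing.ring ring) using (-‿distribˡ-*; -‿distribʳ-*)
  open import Algebra.Properties.Group +-group using (//-rightDividesˡ; //-rightDividesʳ; x∙y⁻¹≈ε⇒x≈y)
  -- Only the semiring solver is usable: the ring solver normalises by deciding equality of
  -- coefficients in the carrier, which does not compute for an abstract field.
  open import Algebra.Solver.Ring.NaturalCoefficients.Default commutativeSemiring using (solve; _:=_; _:+_; _:*_)

  instance
    size-nonZero : ℕ.NonZero size
    size-nonZero = nonZeroIndex (to 0#)

  _≟_ : DecidableEquality Carrier
  _≟_ = inj⇒≟ (↔⇒↣ enum)

  elements : List Carrier
  elements = map from (allFin size)

  elements-unique : Unique elements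
  elements-unique = Unique.map⁺ from-injective (Unique.allFin⁺ size)
    where
    from-injective : ∀ {i j} → from i ≡ from j → i ≡ j
    from-injective {i} {j} eq = trans (sym (strictlyInverseˡ _)) (trans (cong to eq) (strictlyInverseˡ _))

  ∈-elements : ∀ x → x ∈ elements
  ∈-elements x = subst (_∈ elements) (strictlyInverseʳ _) (∈-map⁺ from (∈-allFin (to x)))

  length-elements : length elements ≡ size
  length-elements = trans (length-map from (allFin size)) (length-tabulate {n = size} (λ i → i))

  fromRows : Carrier × Carrier → Carrier × Carrier → M2 F
  fromRows (a , b) (c , d) = mat a b c d

  fromRows-injective : ∀ {r r′ s s′} → fromRows r s ≡ fromRows r′ s′ → r ≡ r′ × s ≡ s′
  fromRows-injective {_ , _} {_ , _} {_ , _} {_ , _} refl = refl , refl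

  matrices : List (M2 F)
  matrices = cartesianProductWith fromRows rows rows
    where rows = cartesianProduct elements elements

  matrices-unique : Unique matrices
  matrices-unique = Unique.cartesianProductWith⁺ fromRows fromRows-injective rows-unique rows-unique
    where rows-unique = Unique.cartesianProduct⁺ elements-unique elements-unique

  ∈-matrices : ∀ m → m ∈ matrices
  ∈-matrices (mat a b c d) = ∈-cartesianProductWith⁺ fromRows (∈-row a b) (∈-row c d)
    where ∈-row = λ x y → ∈-cartesianProduct⁺ (∈-elements x) (∈-elements y)

  ∑-matrices : (g : M2 F → ℕ) →
    ∑ matrices g ≡ ∑ elements (λ a → ∑ elements (λ b → ∑ elements (λ c → ∑ elements (λ d → g (mat a b c d)))))
  ∑-matrices g = begin
    ∑ matrices g                                                                   ≡⟨ ∑-cartesianProductWith fromRows rows rows g ⟩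
    ∑ rows (λ r → ∑ rows (λ s → g (fromRows r s)))                                 ≡⟨ ∑-cartesianProductWith _,_ elements elements _ ⟩
    ∑ elements (λ a → ∑ elements (λ b → ∑ rows (λ s → g (fromRows (a , b) s))))    ≡⟨ ∑-cong elements (λ _ → ∑-cong elements (λ _ →
                                                                                      ∑-cartesianProductWith _,_ elements elements _)) ⟩
    ∑ elements (λ a → ∑ elements (λ b → ∑ elements (λ c → ∑ elements (λ d → g (mat a b c d))))) ∎
    where
    open ≡-Reasoning
    rows = cartesianProduct elements elements

  length-matrices : length matrices ≡ size ^ 4
  length-matrices = begin
    length matrices                                ≡⟨ length-cartesianProductWith fromRows rows rows ⟩
    length rows ℕ.* length rows                    ≡⟨ cong (λ r → r ℕ.* r) (trans (length-cartesianProductWith _,_ elements elements)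
                                                                            (cong (λ e → e ℕ.* e) length-elements)) ⟩
    (size ℕ.* size) ℕ.* (size ℕ.* size)            ≡⟨ NatSolver.solve 1 (λ q → (q :× q) :× (q :× q) :≡ q :^ 4) refl size ⟩
    size ^ 4                                       ∎
    where
    open ≡-Reasoning
    open NatSolver using (_:^_) renaming (_:*_ to _:×_; _:=_ to _:≡_)
    rows = cartesianProduct elements elements

  mat-cong : ∀ {a b c d a′ b′ c′ d′} → a ≡ a′ → b ≡ b′ → c ≡ c′ → d ≡ d′ → mat {F} a b c d ≡ mat a′ b′ c′ d′
  mat-cong refl refl refl refl = refl

  _≟ₘ_ : DecidableEquality (M2 F)
  _≟ₘ_ = via-injection (mk↣ entries-injective) (≡-dec _≟_ (≡-dec _≟_ (≡-dec _≟_ _≟_)))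
    where
    entries : M2 F → Carrier × Carrier × Carrier × Carrier
    entries (mat a b c d) = a , b , c , d
    entries-injective : ∀ {m m′} → entries m ≡ entries m′ → m ≡ m′
    entries-injective {mat _ _ _ _} {mat _ _ _ _} refl = refl

  -ₘ_ : M2 F → M2 F
  -ₘ mat a b c d = mat (- a) (- b) (- c) (- d)

  _-ₘ_ : M2 F → M2 F → M2 F
  m -ₘ m′ = m +ₘ (-ₘ m′)

  +ₘ-comm : ∀ m m′ → m +ₘ m′ ≡ m′ +ₘ m
  +ₘ-comm (mat a b c d) (mat a′ b′ c′ d′) = mat-cong (+-comm a a′) (+-comm b b′) (+-comm c c′) (+-comm d d′)

  [m+n]-n≡m : ∀ m n → (m +ₘ n) -ₘ n ≡ m
  [m+n]-n≡m (mat a b c d) (mat a′ b′ c′ d′) =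
    mat-cong (//-rightDividesʳ a′ a) (//-rightDividesʳ b′ b) (//-rightDividesʳ c′ c) (//-rightDividesʳ d′ d)

  [m-n]+n≡m : ∀ m n → (m -ₘ n) +ₘ n ≡ m
  [m-n]+n≡m (mat a b c d) (mat a′ b′ c′ d′) =
    mat-cong (//-rightDividesˡ a′ a) (//-rightDividesˡ b′ b) (//-rightDividesˡ c′ c) (//-rightDividesˡ d′ d)

  1ₘ : M2 F
  1ₘ = mat 1# 0# 0# 1#

  _·ₘ_ : Carrier → M2 F → M2 F
  y ·ₘ mat a b c d = mat (y * a) (y * b) (y * c) (y * d)

  *ₘ-assoc : ∀ m m′ m″ → (m *ₘ m′) *ₘ m″ ≡ m *ₘ (m′ *ₘ m″)
  *ₘ-assoc (mat a b c d) (mat a′ b′ c′ d′) (mat a″ b″ c″ d″) = mat-cong (column₁ a b) (column₂ a b) (column₁ c d) (column₂ c d)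
    where
    column₁ : ∀ x y → (x * a′ + y * c′) * a″ + (x * b′ + y * d′) * c″ ≡ x * (a′ * a″ + b′ * c″) + y * (c′ * a″ + d′ * c″)
    column₁ x y = solve 8 (λ x y a′ b′ c′ d′ a″ c″ → (x :* a′ :+ y :* c′) :* a″ :+ (x :* b′ :+ y :* d′) :* c″
                                             := x :* (a′ :* a″ :+ b′ :* c″) :+ y :* (c′ :* a″ :+ d′ :* c″)) refl x y a′ b′ c′ d′ a″ c″
    column₂ : ∀ x y → (x * a′ + y * c′) * b″ + (x * b′ + y * d′) * d″ ≡ x * (a′ * b″ + b′ * d″) + y * (c′ * b″ + d′ * d″)
    column₂ x y = solve 8 (λ x y a′ b′ c′ d′ b″ d″ → (x :* a′ :+ y :* c′) :* b″ :+ (x :* b′ :+ y :* d′) :* d″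
                                              := x :* (a′ :* b″ :+ b′ :* d″) :+ y :* (c′ :* b″ :+ d′ :* d″)) refl x y a′ b′ c′ d′ b″ d″

  *ₘ-identityʳ : ∀ m → m *ₘ 1ₘ ≡ m
  *ₘ-identityʳ (mat a b c d) = mat-cong (x1+y0≡x a b) (x0+y1≡y a b) (x1+y0≡x c d) (x0+y1≡y c d)
    where
    x1+y0≡x : ∀ x y → x * 1# + y * 0# ≡ x
    x1+y0≡x x y = trans (cong₂ _+_ (*-identityʳ x) (zeroʳ y)) (+-identityʳ x)
    x0+y1≡y : ∀ x y → x * 0# + y * 1# ≡ y
    x0+y1≡y x y = trans (cong₂ _+_ (zeroʳ x) (*-identityʳ y)) (+-identityˡ y)

  +ₘ-*ₘ-distribˡ : ∀ a b d e → a +ₘ (b *ₘ (d +ₘ e)) ≡ (a +ₘ (b *ₘ d)) +ₘ (b *ₘ e)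
  +ₘ-*ₘ-distribˡ (mat a₁ a₂ a₃ a₄) (mat b₁ b₂ b₃ b₄) (mat d₁ d₂ d₃ d₄) (mat e₁ e₂ e₃ e₄) =
    mat-cong (entry a₁ b₁ b₂ d₁ d₃ e₁ e₃) (entry a₂ b₁ b₂ d₂ d₄ e₂ e₄) (entry a₃ b₃ b₄ d₁ d₃ e₁ e₃) (entry a₄ b₃ b₄ d₂ d₄ e₂ e₄)
    where
    entry : ∀ x p r u w v z → x + (p * (u + v) + r * (w + z)) ≡ (x + (p * u + r * w)) + (p * v + r * z)
    entry = solve 7 (λ x p r u w v z → x :+ (p :* (u :+ v) :+ r :* (w :+ z)) := (x :+ (p :* u :+ r :* w)) :+ (p :* v :+ r :* z)) refl

  *ₘ-·ₘ-commute : ∀ y m m′ → m *ₘ (y ·ₘ m′) ≡ y ·ₘ (m *ₘ m′)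
  *ₘ-·ₘ-commute y (mat a b c d) (mat a′ b′ c′ d′) = mat-cong (entry a b a′ c′) (entry a b b′ d′) (entry c d a′ c′) (entry c d b′ d′)
    where
    entry : ∀ p r u v → p * (y * u) + r * (y * v) ≡ y * (p * u + r * v)
    entry p r u v = solve 5 (λ y p r u v → p :* (y :* u) :+ r :* (y :* v) := y :* (p :* u :+ r :* v)) refl y p r u v

  ·ₘ-*ₘ-assoc : ∀ y m m′ → (y ·ₘ m) *ₘ m′ ≡ y ·ₘ (m *ₘ m′)
  ·ₘ-*ₘ-assoc y (mat a b c d) (mat a′ b′ c′ d′) = mat-cong (entry a b a′ c′) (entry a b b′ d′) (entry c d a′ c′) (entry c d b′ d′)
    where
    entry : ∀ p r u v → (y * p) * u + (y * r) * v ≡ y * (p * u + r * v)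
    entry p r u v = solve 5 (λ y p r u v → (y :* p) :* u :+ (y :* r) :* v := y :* (p :* u :+ r :* v)) refl y p r u v

  det : M2 F → Carrier
  det (mat a b c d) = a * d - b * c

  adj : M2 F → M2 F
  adj (mat a b c d) = mat d (- b) (- c) a

  diag : Carrier → M2 F
  diag x = mat x 0# 0# x

  private
    x*-y≡-xy : ∀ x y → x * - y ≡ - (x * y)
    x*-y≡-xy x y = sym (-‿distribʳ-* x y)

    -x*y≡-xy : ∀ x y → - x * y ≡ - (x * y)
    -x*y≡-xy x y = sym (-‿distribˡ-* x y)

    xy-yx≡0 : ∀ x y → x * y - y * x ≡ 0#
    xy-yx≡0 x y = trans (cong (λ z → x * y - z) (*-comm y x)) (-‿inverseʳ (x * y))

    -xy+yx≡0 : ∀ x y → - (x * y) + y * x ≡ 0#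
    -xy+yx≡0 x y = trans (cong (- (x * y) +_) (*-comm y x)) (-‿inverseˡ (x * y))

  *ₘ-adj : ∀ m → m *ₘ adj m ≡ diag (det m)
  *ₘ-adj (mat a b c d) = mat-cong
    (cong (a * d +_) (x*-y≡-xy b c))
    (trans (cong (_+ b * a) (x*-y≡-xy a b)) (-xy+yx≡0 a b))
    (trans (cong (c * d +_) (x*-y≡-xy d c)) (xy-yx≡0 c d))
    (trans (cong₂ _+_ (trans (x*-y≡-xy c b) (cong -_ (*-comm c b))) (*-comm d a)) (+-comm (- (b * c)) (a * d)))

  adj-*ₘ : ∀ m → adj m *ₘ m ≡ diag (det m)
  adj-*ₘ (mat a b c d) = mat-cong
    (cong₂ _+_ (*-comm d a) (-x*y≡-xy b c))
    (trans (cong (d * b +_) (-x*y≡-xy b d)) (xy-yx≡0 d b))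
    (trans (cong (_+ a * c) (-x*y≡-xy c a)) (-xy+yx≡0 c a))
    (trans (cong (_+ a * d) (trans (-x*y≡-xy c b) (cong -_ (*-comm c b)))) (+-comm (- (b * c)) (a * d)))

  ·ₘ-diag : ∀ y x → y ·ₘ diag x ≡ diag (y * x)
  ·ₘ-diag y x = mat-cong refl (zeroʳ y) (zeroʳ y) refl

  module _ {m : M2 F} {y : Carrier} (y*det≡1 : y * det m ≡ 1#) where

    m⁻¹ : M2 F
    m⁻¹ = y ·ₘ adj m

    *ₘ-inverseʳ : m *ₘ m⁻¹ ≡ 1ₘ
    *ₘ-inverseʳ = begin
      m *ₘ (y ·ₘ adj m)   ≡⟨ *ₘ-·ₘ-commute y m (adj m) ⟩
      y ·ₘ (m *ₘ adj m)   ≡⟨ cong (y ·ₘ_) (*ₘ-adj m) ⟩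
      y ·ₘ diag (det m)   ≡⟨ ·ₘ-diag y (det m) ⟩
      diag (y * det m)    ≡⟨ cong diag y*det≡1 ⟩
      1ₘ                  ∎
      where open ≡-Reasoning

    *ₘ-inverseˡ : m⁻¹ *ₘ m ≡ 1ₘ
    *ₘ-inverseˡ = begin
      (y ·ₘ adj m) *ₘ m   ≡⟨ ·ₘ-*ₘ-assoc y (adj m) m ⟩
      y ·ₘ (adj m *ₘ m)   ≡⟨ cong (y ·ₘ_) (adj-*ₘ m) ⟩
      y ·ₘ diag (det m)   ≡⟨ ·ₘ-diag y (det m) ⟩
      diag (y * det m)    ≡⟨ cong diag y*det≡1 ⟩
      1ₘ                  ∎
      where open ≡-Reasoning

    [nm]m⁻¹≡n : ∀ n → (n *ₘ m) *ₘ m⁻¹ ≡ n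
    [nm]m⁻¹≡n n = trans (*ₘ-assoc n m m⁻¹) (trans (cong (n *ₘ_) *ₘ-inverseʳ) (*ₘ-identityʳ n))

    [nm⁻¹]m≡n : ∀ n → (n *ₘ m⁻¹) *ₘ m ≡ n
    [nm⁻¹]m≡n n = trans (*ₘ-assoc n m⁻¹ m) (trans (cong (n *ₘ_) *ₘ-inverseˡ) (*ₘ-identityʳ n))

  *-cancelˡ : ∀ {a x x′} → a ≢ 0# → a * x ≡ a * x′ → x ≡ x′
  *-cancelˡ {a} {x} {x′} a≢0 ax≡ax′ = trans (x≡a⁻¹[ax] x) (trans (cong (a⁻¹ *_) ax≡ax′) (sym (x≡a⁻¹[ax] x′)))
    where
    a⁻¹ = proj₁ (inverse a a≢0)
    x≡a⁻¹[ax] : ∀ x → x ≡ a⁻¹ * (a * x)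
    x≡a⁻¹[ax] x = begin
      x                ≡⟨ *-identityˡ x ⟨
      1# * x           ≡⟨ cong (_* x) (trans (sym (proj₂ (inverse a a≢0))) (*-comm a a⁻¹)) ⟩
      (a⁻¹ * a) * x    ≡⟨ *-assoc a⁻¹ a x ⟩
      a⁻¹ * (a * x)    ∎
      where open ≡-Reasoning

  det≡0⇒ad≡bc : ∀ {a b c d} → det (mat a b c d) ≡ 0# → a * d ≡ b * c
  det≡0⇒ad≡bc {a} {b} {c} {d} = x∙y⁻¹≈ε⇒x≈y (a * d) (b * c)

  ∑-const-elements : ∀ k → ∑ elements (λ _ → k) ≡ size ℕ.* k
  ∑-const-elements k = trans (∑-const elements k) (cong (ℕ._* k) length-elements)

  singular-fibre-bound : ∀ a b c → ∑ elements (λ d → 𝟙 (det (mat a b c d) ≟ 0#)) ≤ 𝟙 (a ≟ 0#) ℕ.* size ℕ.+ 1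
  singular-fibre-bound a b c with a ≟ 0#
  ... | yes _    = ℕₚ.≤-trans (∑-mono elements (λ d → 𝟙≤1 (det (mat a b c d) ≟ 0#)))
                     (ℕₚ.≤-trans (ℕₚ.≤-reflexive (trans (∑-const-elements 1) (ℕₚ.*-comm size 1))) (ℕₚ.m≤m+n (1 ℕ.* size) 1))
  ... | no a≢0   = ∑-𝟙≤1 (λ d → det (mat a b c d) ≟ 0#) elements-unique
    (λ det≡0 det′≡0 → *-cancelˡ a≢0 (trans (det≡0⇒ad≡bc det≡0) (sym (det≡0⇒ad≡bc det′≡0))))

  singular-count : ∑ matrices (λ m → 𝟙 (det m ≟ 0#)) ≤ 2 ℕ.* size ^ 3
  singular-count = begin
    ∑ matrices (λ m → 𝟙 (det m ≟ 0#))
      ≡⟨ ∑-matrices _ ⟩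
    ∑ elements (λ a → ∑ elements (λ b → ∑ elements (λ c → ∑ elements (λ d → 𝟙 (det (mat a b c d) ≟ 0#)))))
      ≤⟨ ∑-mono elements (λ a → ∑-mono elements (λ b → ∑-mono elements (λ c → singular-fibre-bound a b c))) ⟩
    ∑ elements (λ a → ∑ elements (λ _ → ∑ elements (λ _ → 𝟙 (a ≟ 0#) ℕ.* size ℕ.+ 1)))
      ≡⟨ ∑-cong elements (λ _ → trans (∑-cong elements (λ _ → ∑-const-elements _)) (∑-const-elements _)) ⟩
    ∑ elements (λ a → size ℕ.* (size ℕ.* (𝟙 (a ≟ 0#) ℕ.* size ℕ.+ 1)))
      ≡⟨ trans (∑-*ˡ elements size _) (cong (size ℕ.*_) (∑-*ˡ elements size _)) ⟩
    size ℕ.* (size ℕ.* ∑ elements (λ a → 𝟙 (a ≟ 0#) ℕ.* size ℕ.+ 1))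
      ≡⟨ cong (λ e → size ℕ.* (size ℕ.* e)) (trans (∑-+ elements _ _) (cong₂ ℕ._+_ (∑-*ʳ elements size _) (∑-const-elements 1))) ⟩
    size ℕ.* (size ℕ.* (∑ elements (λ a → 𝟙 (a ≟ 0#)) ℕ.* size ℕ.+ size ℕ.* 1))
      ≤⟨ ℕₚ.*-monoʳ-≤ size (ℕₚ.*-monoʳ-≤ size (ℕₚ.+-monoˡ-≤ (size ℕ.* 1) (ℕₚ.*-monoˡ-≤ size zero-unique))) ⟩
    size ℕ.* (size ℕ.* (1 ℕ.* size ℕ.+ size ℕ.* 1))
      ≡⟨ NatSolver.solve 1 (λ q → q :× (q :× (con 1 :× q :⊕ q :× con 1)) :≡ con 2 :× (q :× (q :× (q :× con 1)))) refl size ⟩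
    2 ℕ.* size ^ 3 ∎
    where
    open ℕₚ.≤-Reasoning
    open NatSolver using (con) renaming (_:*_ to _:×_; _:+_ to _:⊕_; _:=_ to _:≡_)
    zero-unique : ∑ elements (λ a → 𝟙 (a ≟ 0#)) ≤ 1
    zero-unique = ∑-𝟙≤1 (_≟ 0#) elements-unique (λ a≡0 a′≡0 → trans a≡0 (sym a′≡0))

  ∑-translate : ∀ c (g : M2 F → ℕ) → ∑ matrices (λ a → g (a +ₘ c)) ≡ ∑ matrices g
  ∑-translate c = ∑-reindex matrices-unique ∈-matrices (λ a → [m+n]-n≡m a c) (λ a → [m-n]+n≡m a c)

  ∑-*ₘ-nonsingular : ∀ {m} → det m ≢ 0# → (g : M2 F → ℕ) → ∑ matrices (λ b → g (b *ₘ m)) ≡ ∑ matrices g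
  ∑-*ₘ-nonsingular {m} det≢0 = ∑-reindex matrices-unique ∈-matrices ([nm]m⁻¹≡n y*det≡1) ([nm⁻¹]m≡n y*det≡1)
    where
    y = proj₁ (inverse (det m) det≢0)
    y*det≡1 : y * det m ≡ 1#
    y*det≡1 = trans (*-comm y (det m)) (proj₂ (inverse (det m) det≢0))

module SumProduct {F : FiniteField} (A B D : FinSet F) where

  open import Data.Nat as ℕ using (ℕ; _+_; _*_; _^_; _≤_; _∸_; ∣_-_∣)
  import Data.Nat.Properties as ℕₚ
  import Data.Nat.Solver
  open import Data.Product using (_×_; _,_; proj₁; proj₂)
  open import Data.List using (List; length; filter; cartesianProductWith; cartesianProduct)
  open import Data.List.Properties using (length-filter)
  open import Data.List.Membership.Propositional using (_∈_)
  open import Data.List.Membership.Propositional.Properties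
    using (∈-cartesianProductWith⁺; ∈-cartesianProductWith⁻; ∈-cartesianProduct⁺; ∈-cartesianProduct⁻)
  open import Data.List.Relation.Unary.All as All using (All)
  open import Data.List.Relation.Unary.All.Properties using (all-filter)
  open import Data.List.Relation.Unary.Unique.Propositional using (Unique)
  import Data.List.Relation.Unary.Unique.Propositional.Properties as Unique
  open import Relation.Binary.PropositionalEquality
  open import Relation.Nullary using (yes; no; contradiction)
  open FiniteSums
  open Arithmetic

  open Matrices F
  open FiniteField F using (size; 0#)
  open FinSet A using () renaming (elems to As)
  open FinSet B using () renaming (elems to Bs)
  open FinSet D using () renaming (elems to Ds)
  open import Data.List.Membership.DecPropositional _≟ₘ_ using (_∈?_)

  sums : List (M2 F)
  sums = cartesianProductWith (λ a bd → a +ₘ (proj₁ bd *ₘ proj₂ bd)) As (cartesianProduct Bs Ds)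

  ∈-sums⁺ : ∀ {a b d} → a ∈ₛ A → b ∈ₛ B → d ∈ₛ D → a +ₘ (b *ₘ d) ∈ sums
  ∈-sums⁺ a∈A b∈B d∈D = ∈-cartesianProductWith⁺ _ a∈A (∈-cartesianProduct⁺ b∈B d∈D)

  ∈-sums⁻ : ∀ {y} → y ∈ sums → InSumProd A B D y
  ∈-sums⁻ y∈sums with a , (b , d) , a∈A , bd∈B×D , refl ← ∈-cartesianProductWith⁻ _ As (cartesianProduct Bs Ds) y∈sums
    = a , b , d , a∈A , proj₁ (∈-cartesianProduct⁻ Bs Ds bd∈B×D) , proj₂ (∈-cartesianProduct⁻ Bs Ds bd∈B×D) , refl

  S : List (M2 F)
  S = filter (_∈? sums) matrices

  s n δ : ℕ
  s = length S
  n = size ^ 4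
  δ = length Ds

  χ : M2 F → ℕ
  χ y = 𝟙 (y ∈? sums)

  ∑-χ : ∑ matrices χ ≡ s
  ∑-χ = ∑-𝟙≡length-filter (_∈? sums) matrices

  χ[a+bd]≡1 : ∀ {a b d} → a ∈ₛ A → b ∈ₛ B → d ∈ₛ D → χ (a +ₘ (b *ₘ d)) ≡ 1
  χ[a+bd]≡1 {a} {b} {d} a∈A b∈B d∈D with a +ₘ (b *ₘ d) ∈? sums
  ... | yes _            = refl
  ... | no  sum∉sums     = contradiction (∈-sums⁺ a∈A b∈B d∈D) sum∉sums

  s≤n : s ≤ n
  s≤n = subst (s ≤_) length-matrices (length-filter (_∈? sums) matrices)

  ∑-matrices-const : ∀ k → ∑ matrices (λ _ → k) ≡ n * k
  ∑-matrices-const k = trans (∑-const matrices k) (cong (_* k) length-matrices)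

  pairs : List (M2 F × M2 F)
  pairs = cartesianProduct matrices matrices

  ∑-pairs : ∀ (g : M2 F × M2 F → ℕ) → ∑ pairs g ≡ ∑ matrices (λ a → ∑ matrices (λ b → g (a , b)))
  ∑-pairs = ∑-cartesianProductWith _,_ matrices matrices

  hits : M2 F × M2 F → ℕ
  hits (a , b) = ∑ Ds (λ d → χ (a +ₘ (b *ₘ d)))

  ∑-hits : ∑ pairs hits ≡ δ * (n * s)
  ∑-hits = begin
    ∑ pairs hits                                                       ≡⟨ ∑-pairs hits ⟩
    ∑ matrices (λ a → ∑ matrices (λ b → ∑ Ds (λ d → χ (a +ₘ (b *ₘ d)))))  ≡⟨ ∑-cong matrices (λ _ → ∑-swap matrices Ds _) ⟩
    ∑ matrices (λ a → ∑ Ds (λ d → ∑ matrices (λ b → χ (a +ₘ (b *ₘ d)))))  ≡⟨ ∑-swap matrices Ds _ ⟩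
    ∑ Ds (λ d → ∑ matrices (λ a → ∑ matrices (λ b → χ (a +ₘ (b *ₘ d)))))  ≡⟨ ∑-cong Ds (λ _ → ∑-swap matrices matrices _) ⟩
    ∑ Ds (λ d → ∑ matrices (λ b → ∑ matrices (λ a → χ (a +ₘ (b *ₘ d)))))  ≡⟨ ∑-cong Ds (λ {d} _ → ∑-cong matrices (λ {b} _ → trans (∑-translate (b *ₘ d) χ) ∑-χ)) ⟩
    ∑ Ds (λ _ → ∑ matrices (λ _ → s))                                   ≡⟨ ∑-cong Ds (λ _ → ∑-matrices-const s) ⟩
    ∑ Ds (λ _ → n * s)                                                  ≡⟨ ∑-const Ds (n * s) ⟩
    δ * (n * s)                                                         ∎
    where open ≡-Reasoning

  χ≤1 : ∀ y → χ y ≤ 1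
  χ≤1 y = 𝟙≤1 (y ∈? sums)

  line-bound : ∀ m a → ∑ matrices (λ b → χ (a +ₘ (b *ₘ m))) ≤ s + 𝟙 (det m ≟ 0#) * n
  line-bound m a with det m ≟ 0#
  ... | yes _      = ℕₚ.≤-trans (∑-mono matrices (λ b → χ≤1 (a +ₘ (b *ₘ m))))
                      (ℕₚ.≤-trans (ℕₚ.≤-reflexive (trans (∑-matrices-const 1) (ℕₚ.*-comm n 1))) (ℕₚ.m≤n+m (1 * n) s))
  ... | no  det≢0  = ℕₚ.≤-reflexive (begin
    ∑ matrices (λ b → χ (a +ₘ (b *ₘ m)))  ≡⟨ ∑-*ₘ-nonsingular det≢0 (λ z → χ (a +ₘ z)) ⟩
    ∑ matrices (λ b → χ (a +ₘ b))         ≡⟨ ∑-cong matrices (λ {b} _ → cong χ (+ₘ-comm a b)) ⟩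
    ∑ matrices (λ b → χ (b +ₘ a))         ≡⟨ ∑-translate a χ ⟩
    ∑ matrices χ                          ≡⟨ ∑-χ ⟩
    s                                     ≡⟨ ℕₚ.+-identityʳ s ⟨
    s + 0 * n                             ∎)
    where open ≡-Reasoning

  correlation-bound : ∀ d d′ →
    ∑ pairs (λ (a , b) → χ (a +ₘ (b *ₘ d)) * χ (a +ₘ (b *ₘ d′))) ≤ s * s + 𝟙 (det (d′ -ₘ d) ≟ 0#) * (n * s)
  correlation-bound d d′ = begin
    ∑ pairs (λ (a , b) → χ (a +ₘ (b *ₘ d)) * χ (a +ₘ (b *ₘ d′)))
      ≡⟨ trans (∑-pairs _) (∑-swap matrices matrices _) ⟩
    ∑ matrices (λ b → ∑ matrices (λ a → χ (a +ₘ (b *ₘ d)) * χ (a +ₘ (b *ₘ d′))))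
      ≡⟨ ∑-cong matrices (λ {b} _ → ∑-cong matrices (λ {a} _ → cong (λ z → χ (a +ₘ (b *ₘ d)) * χ z) (split a b))) ⟩
    ∑ matrices (λ b → ∑ matrices (λ a → χ (a +ₘ (b *ₘ d)) * χ ((a +ₘ (b *ₘ d)) +ₘ (b *ₘ m))))
      ≡⟨ ∑-cong matrices (λ {b} _ → ∑-translate (b *ₘ d) (λ x → χ x * χ (x +ₘ (b *ₘ m)))) ⟩
    ∑ matrices (λ b → ∑ matrices (λ a → χ a * χ (a +ₘ (b *ₘ m))))
      ≡⟨ ∑-swap matrices matrices _ ⟩
    ∑ matrices (λ a → ∑ matrices (λ b → χ a * χ (a +ₘ (b *ₘ m))))
      ≡⟨ ∑-cong matrices (λ {a} _ → ∑-*ˡ matrices (χ a) _) ⟩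
    ∑ matrices (λ a → χ a * ∑ matrices (λ b → χ (a +ₘ (b *ₘ m))))
      ≤⟨ ∑-mono matrices (λ a → ℕₚ.*-monoʳ-≤ (χ a) (line-bound m a)) ⟩
    ∑ matrices (λ a → χ a * (s + 𝟙 (det m ≟ 0#) * n))
      ≡⟨ trans (∑-*ʳ matrices _ χ) (cong (_* (s + 𝟙 (det m ≟ 0#) * n)) ∑-χ) ⟩
    s * (s + 𝟙 (det m ≟ 0#) * n)
      ≡⟨ solve 3 (λ s i n → s :* (s :+ i :* n) := s :* s :+ i :* (n :* s)) refl s (𝟙 (det m ≟ 0#)) n ⟩
    s * s + 𝟙 (det m ≟ 0#) * (n * s) ∎
    where
    open ℕₚ.≤-Reasoning
    open Data.Nat.Solver.+-*-Solver
    m = d′ -ₘ d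
    split : ∀ a b → a +ₘ (b *ₘ d′) ≡ (a +ₘ (b *ₘ d)) +ₘ (b *ₘ m)
    split a b = trans (cong (λ z → a +ₘ (b *ₘ z)) (sym (trans (+ₘ-comm d m) ([m-n]+n≡m d′ d)))) (+ₘ-*ₘ-distribˡ a b d m)

  singular-differences : ∀ d → ∑ Ds (λ d′ → 𝟙 (det (d′ -ₘ d) ≟ 0#)) ≤ 2 * size ^ 3
  singular-differences d = begin
    ∑ Ds (λ d′ → 𝟙 (det (d′ -ₘ d) ≟ 0#))        ≤⟨ ∑-mono-⊆ _ (FinSet.unique D) (λ _ → ∈-matrices _) ⟩
    ∑ matrices (λ m → 𝟙 (det (m -ₘ d) ≟ 0#))    ≡⟨ ∑-translate (-ₘ d) (λ m → 𝟙 (det m ≟ 0#)) ⟩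
    ∑ matrices (λ m → 𝟙 (det m ≟ 0#))           ≤⟨ singular-count ⟩
    2 * size ^ 3                                ∎
    where open ℕₚ.≤-Reasoning

  ∑-hits² : ∑ pairs (λ p → hits p * hits p) ≤ (δ * s) * (δ * s) + δ * (2 * size ^ 3) * (n * s)
  ∑-hits² = begin
    ∑ pairs (λ p → hits p * hits p)
      ≡⟨ ∑-cong pairs (λ {p} _ → ∑-*-∑ Ds Ds _ _) ⟩
    ∑ pairs (λ p → ∑ Ds (λ d → ∑ Ds (λ d′ → C p d d′)))
      ≡⟨ ∑-swap pairs Ds _ ⟩
    ∑ Ds (λ d → ∑ pairs (λ p → ∑ Ds (λ d′ → C p d d′)))
      ≡⟨ ∑-cong Ds (λ _ → ∑-swap pairs Ds _) ⟩
    ∑ Ds (λ d → ∑ Ds (λ d′ → ∑ pairs (λ p → C p d d′)))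
      ≤⟨ ∑-mono Ds (λ d → ∑-mono Ds (λ d′ → correlation-bound d d′)) ⟩
    ∑ Ds (λ d → ∑ Ds (λ d′ → s * s + 𝟙 (det (d′ -ₘ d) ≟ 0#) * (n * s)))
      ≡⟨ ∑-cong Ds (λ {d} _ → trans (∑-+ Ds _ _) (cong₂ _+_ (∑-const Ds (s * s)) (∑-*ʳ Ds (n * s) _))) ⟩
    ∑ Ds (λ d → δ * (s * s) + ∑ Ds (λ d′ → 𝟙 (det (d′ -ₘ d) ≟ 0#)) * (n * s))
      ≤⟨ ∑-mono Ds (λ d → ℕₚ.+-monoʳ-≤ (δ * (s * s)) (ℕₚ.*-monoˡ-≤ (n * s) (singular-differences d))) ⟩
    ∑ Ds (λ _ → δ * (s * s) + 2 * size ^ 3 * (n * s))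
      ≡⟨ ∑-const Ds _ ⟩
    δ * (δ * (s * s) + 2 * size ^ 3 * (n * s))
      ≡⟨ solve 4 (λ δ s Z N → δ :* (δ :* (s :* s) :+ Z :* N) := (δ :* s) :* (δ :* s) :+ δ :* Z :* N) refl δ s (2 * size ^ 3) (n * s) ⟩
    (δ * s) * (δ * s) + δ * (2 * size ^ 3) * (n * s) ∎
    where
    open ℕₚ.≤-Reasoning
    open Data.Nat.Solver.+-*-Solver
    C : M2 F × M2 F → M2 F → M2 F → ℕ
    C (a , b) d d′ = χ (a +ₘ (b *ₘ d)) * χ (a +ₘ (b *ₘ d′))

  hits-on-A×B : ∀ {a b} → a ∈ₛ A → b ∈ₛ B → hits (a , b) ≡ δ
  hits-on-A×B a∈A b∈B = trans (∑-cong Ds (χ[a+bd]≡1 a∈A b∈B)) (trans (∑-const Ds 1) (ℕₚ.*-identityʳ δ))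

  t : ℕ
  t = n ∸ s

  -- n times the deviation of hits from its mean δ s / n, which keeps everything in ℕ.
  deviation : M2 F × M2 F → ℕ
  deviation p = ∣ n * hits p - δ * s ∣

  deviation-on-A×B : ∀ {a b} → a ∈ₛ A → b ∈ₛ B → deviation (a , b) ≡ δ * t
  deviation-on-A×B a∈A b∈B = begin
    ∣ n * hits _ - δ * s ∣  ≡⟨ cong (λ h → ∣ h - δ * s ∣) (trans (cong (n *_) (hits-on-A×B a∈A b∈B)) (ℕₚ.*-comm n δ)) ⟩
    ∣ δ * n - δ * s ∣       ≡⟨ ℕₚ.*-distribˡ-∣-∣ δ n s ⟨
    δ * ∣ n - s ∣           ≡⟨ cong (δ *_) (trans (ℕₚ.∣-∣-comm n s) (ℕₚ.m≤n⇒∣m-n∣≡n∸m s≤n)) ⟩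
    δ * t                   ∎
    where open ≡-Reasoning

  ∑-deviation²-lower : card A * card B * ((δ * t) * (δ * t)) ≤ ∑ pairs (λ p → deviation p * deviation p)
  ∑-deviation²-lower = begin
    card A * card B * ((δ * t) * (δ * t))               ≡⟨ cong (_* ((δ * t) * (δ * t))) (length-cartesianProductWith _,_ As Bs) ⟨
    length A×B * ((δ * t) * (δ * t))                    ≡⟨ ∑-const A×B _ ⟨
    ∑ A×B (λ _ → (δ * t) * (δ * t))                     ≡⟨ ∑-cong A×B (λ ab∈A×B → cong (λ e → e * e) (sym (deviation-on ab∈A×B))) ⟩
    ∑ A×B (λ p → deviation p * deviation p)             ≤⟨ ∑-mono-⊆ _ (Unique.cartesianProduct⁺ (FinSet.unique A) (FinSet.unique B))
                                                                     (λ _ → ∈-cartesianProduct⁺ (∈-matrices _) (∈-matrices _)) ⟩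
    ∑ pairs (λ p → deviation p * deviation p)           ∎
    where
    open ℕₚ.≤-Reasoning
    A×B = cartesianProduct As Bs
    deviation-on : ∀ {p} → p ∈ A×B → deviation p ≡ δ * t
    deviation-on p∈A×B = deviation-on-A×B (proj₁ (∈-cartesianProduct⁻ As Bs p∈A×B)) (proj₂ (∈-cartesianProduct⁻ As Bs p∈A×B))

  ∑-deviation² : ∑ pairs (λ p → deviation p * deviation p) + n * n * ((δ * s) * (δ * s)) ≡ n * n * ∑ pairs (λ p → hits p * hits p)
  ∑-deviation² = begin
    ∑ pairs (λ p → deviation p * deviation p) + n * n * ((δ * s) * (δ * s))
      ≡⟨ cong (λ L → ∑ pairs (λ p → deviation p * deviation p) + L * ((δ * s) * (δ * s))) length-pairs ⟨
    ∑ pairs (λ p → deviation p * deviation p) + length pairs * ((δ * s) * (δ * s))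
      ≡⟨ ∑-variance pairs hits n (δ * s) mean ⟩
    n * n * ∑ pairs (λ p → hits p * hits p) ∎
    where
    open ≡-Reasoning
    open Data.Nat.Solver.+-*-Solver
    length-pairs : length pairs ≡ n * n
    length-pairs = trans (length-cartesianProductWith _,_ matrices matrices) (cong₂ _*_ length-matrices length-matrices)
    mean : n * ∑ pairs hits ≡ length pairs * (δ * s)
    mean = trans (cong (n *_) ∑-hits)
                 (trans (solve 3 (λ n δ s → n :* (δ :* (n :* s)) := n :* n :* (δ :* s)) refl n δ s) (cong (_* (δ * s)) (sym length-pairs)))

  n≤2s : 4 * size ^ 11 ≤ card A * card B * card D → n ≤ 2 * s
  n≤2s 4q¹¹≤αβδ = begin
    n        ≡⟨ ℕₚ.m+[n∸m]≡n s≤n ⟨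
    s + t    ≤⟨ ℕₚ.+-monoʳ-≤ s (2t²≤[s+t]s⇒t≤s s t 2t²≤[s+t]s) ⟩
    s + s    ≡⟨ cong (s +_) (ℕₚ.+-identityʳ s) ⟨
    2 * s    ∎
    where
    open ℕₚ.≤-Reasoning
    2t²≤ns : 2 * (t * t) ≤ n * s
    2t²≤ns = 4q¹¹≤αβδ⇒2t²≤q⁴s size {s} {t} {δ} {card A * card B} 4q¹¹≤αβδ
               (ℕₚ.≤-trans ∑-deviation²-lower (a+Nk≡Nr⇒a≤Ny (n * n) ∑-deviation² ∑-hits²))
    2t²≤[s+t]s : 2 * (t * t) ≤ (s + t) * s
    2t²≤[s+t]s = subst (λ N → 2 * (t * t) ≤ N * s) (sym (ℕₚ.m+[n∸m]≡n s≤n)) 2t²≤ns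

  S-unique : Unique S
  S-unique = Unique.filter⁺ (_∈? sums) matrices-unique

  S-sound : All (InSumProd A B D) S
  S-sound = All.map ∈-sums⁻ (all-filter (_∈? sums) matrices)

open import Data.Nat using (ℕ; _*_; _^_; _≤_; _<_; z≤n; s≤s)
open import Data.Product using (Σ; _×_; _,_)
open import Data.List using (List; length)
open import Data.List.Relation.Unary.All using (All)
open import Data.List.Relation.Unary.Unique.Propositional using (Unique)

theorem1p13 : Σ ℕ λ C → Σ ℕ λ k → 0 < C × 0 < k ×
    ((F : FiniteField) → (A B D : FinSet F) →
      C * FiniteField.size F ^ 11 ≤ card A * card B * card D →
      Σ (List (M2 F)) λ L → Unique L × All (InSumProd A B D) L ×
        FiniteField.size F ^ 4 ≤ k * length L)
theorem1p13 = 4 , 2 , s≤s z≤n , s≤s z≤n , λ F A B D 4q¹¹≤αβδ →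
  let open SumProduct A B D in S , S-unique , S-sound , n≤2s 4q¹¹≤αβδ
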